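{- Let $\mathrm{Cat}=\mathcal{R}(C(t),tC(t))$. Then $$\mathrm{Der}(\mathrm{Cat})=\mathcal{R}\Big(\frac{1}{\sqrt{1-4t}},\frac{1-\sqrt{1-4t}}{2}\Big),\qquad (\mathrm{Der}(\mathrm{Cat}))^{ -1}=\mathcal{R}(1-2t,\,t-t^2),$$ and for all $n\ge k\ge0$ the $(n,k)$-entry of $\mathrm{Der}(\mathrm{Cat})$ is $\binom{2n-k}{n-k}$.
   Context: $C(t)=\sum_{n\ge0}C_nt^n=\frac{1-\sqrt{1-4t}}{2t}$ is the Catalan generating function, $C_n=\frac{1}{n+1}\binom{2n}{n}$. For formal power series $d(t),h(t)$ with $d(0)\neq0$, $h(0)=0$, $h'(0)\neq0$, $\mathcal{R}(d(t),h(t))$ is the infinite lower triangular matrix with $(n,k)$-entry $[t^n]\,d(t)h(t)^k$ ($n,k\ge0$); inverses are matrix inverses. $\mathrm{Der}(\mathcal{R}(d(t),h(t)))=\mathcal{R}(h'(t),t\,d(t))$. -}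

module Defs where

open import Data.Nat using (ℕ; zero; suc; _∸_; _≡ᵇ_)
import Data.Nat as ℕ
open import Data.Nat.Combinatorics using (_C_)
open import Data.Integer using (+_)
open import Data.Rational using (ℚ; _/_; 0ℚ; 1ℚ; ½; _+_; _*_; _-_)
open import Data.Bool using (if_then_else_)
open import Relation.Binary.PropositionalEquality using (_≡_)

-- Formal power series over ℚ, represented by their coefficient sequences.
Series : Set
Series = ℕ → ℚ

ι : ℕ → ℚ
ι n = + n / 1

sumTo : ℕ → (ℕ → ℚ) → ℚ
sumTo zero    f = f 0
sumTo (suc n) f = sumTo n f + f (suc n)

one : Series
one n = if n ≡ᵇ 0 then 1ℚ else 0ℚ

X : Series
X n = if n ≡ᵇ 1 then 1ℚ else 0ℚ

infixl 6 _⊕_ _⊖_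
infixl 7 _⊛_ _·_

_⊕_ : Series → Series → Series
(f ⊕ g) n = f n + g n

_⊖_ : Series → Series → Series
(f ⊖ g) n = f n - g n

_·_ : ℚ → Series → Series
(c · f) n = c * f n

_⊛_ : Series → Series → Series
(f ⊛ g) n = sumTo n (λ i → f i * g (n ∸ i))

pow : Series → ℕ → Series
pow h zero    = one
pow h (suc k) = h ⊛ pow h k

deriv : Series → Series
deriv f n = ι (suc n) * f (suc n)

_≈ₛ_ : Series → Series → Set
f ≈ₛ g = ∀ n → f n ≡ g n

catalan : Series
catalan n = + ((2 ℕ.* n) C n) / suc n

-- Infinite matrices indexed by ℕ × ℕ (row n, column k)
Matrix : Set
Matrix = ℕ → ℕ → ℚ

R : Series → Series → Matrix
R d h n k = (d ⊛ pow h k) n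

Der : Series → Series → Matrix
Der d h = R (deriv h) (X ⊛ d)

DerCat : Matrix
DerCat = Der catalan (X ⊛ catalan)

-- Product of lower triangular matrices: (AB)(n,k) = Σ_{j=0}^{n} A(n,j) B(j,k)
-- (the terms j > n of the infinite sum vanish since A is lower triangular)
_⊠_ : Matrix → Matrix → Matrix
(A ⊠ B) n k = sumTo n (λ j → A n j * B j k)

Id : Matrix
Id n k = if n ≡ᵇ k then 1ℚ else 0ℚ

_≈ₘ_ : Matrix → Matrix → Set
A ≈ₘ B = ∀ n k → A n k ≡ B n k

-- Write h = tC, so Der(Cat) = R(h′, h). The recurrence (n+1)·binom(2n+2,n+1) = 2(2n+1)·binom(2n,n)
-- says coefficientwise that (1 − 4t)h′ = 1 − 2h. Differentiating, e = (1 − 2h)² − (1 − 4t) solves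
-- (1 − 4t)e′ = −4e with e(0) = 0, hence vanishes: 1 − 2h is the square root of 1 − 4t, so h = t + h²
-- and h′(1 − 2h) = 1. As square roots and inverses of series with constant term 1 are unique, this
-- identifies Der(Cat) with R(1/√(1 − 4t), (1 − √(1 − 4t))/2). The relation h = t + h² gives the
-- column recurrence D(n+1,k+1) = D(n,k) + D(n+1,k+2); with D(n,0) = binom(2n,n) and h′(1 − 2h) = 1
-- it yields both the binomial formula and Der(Cat)·R(1 − 2t, t − t²) = I. The product in the other
-- order is I because a left inverse of a lower unitriangular matrix is also a right inverse.

module Submission where

open import Defs
open import Data.Nat using (ℕ; zero; suc; _≤_; _<_; _∸_; z≤n; s≤s)
import Data.Nat as ℕ
import Data.Nat.Properties as ℕP
import Data.Nat.Solver
open import Data.Nat.Combinatorics using (_C_; nCk+nC[k+1]≡[n+1]C[k+1]; nCk≡nC[n∸k]; k>n⇒nCk≡0; nC1≡n)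
import Data.Nat.Coprimality as Coprime
open import Data.Integer using (+_)
import Data.Integer as ℤ
import Data.Integer.Properties as ℤP
open import Data.Rational using (ℚ; _/_; ½; 0ℚ; 1ℚ; _+_; _*_; _-_; -_; mkℚ; 1/_; NonZero; toℚᵘ)
import Data.Rational.Properties as ℚP
import Data.Rational.Unnormalised as ℚᵘ
import Data.Rational.Unnormalised.Properties as ℚᵘP
open import Data.Rational.Solver using (module +-*-Solver)
open import Algebra.Properties.Group ℚP.+-0-group using () renaming (x∙y⁻¹≈ε⇒x≈y to x-y≡0⇒x≡y)
open import Data.Product using (_×_; _,_)
open import Data.Sum using (_⊎_; inj₁; inj₂)
open import Data.Empty using (⊥-elim)
open import Function using (_∘_)
open import Relation.Nullary using (yes; no)
open import Relation.Binary.Bundles using (Setoid)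
import Relation.Binary.Reasoning.Setoid as SetoidReasoning
open import Relation.Binary.PropositionalEquality

module _ where

  open Data.Nat.Solver.+-*-Solver using (solve; _:+_; _:*_; con; _:=_)

  [1+k]*[1+m]C[1+k]≡[1+m]*mCk : ∀ m k → suc k ℕ.* (suc m C suc k) ≡ suc m ℕ.* (m C k)
  [1+k]*[1+m]C[1+k]≡[1+m]*mCk zero zero = refl
  [1+k]*[1+m]C[1+k]≡[1+m]*mCk zero (suc k) = begin
    suc (suc k) ℕ.* (1 C suc (suc k)) ≡⟨ cong (suc (suc k) ℕ.*_) (k>n⇒nCk≡0 {1} {suc (suc k)} (s≤s (s≤s z≤n))) ⟩
    suc (suc k) ℕ.* 0                 ≡⟨ ℕP.*-zeroʳ (suc (suc k)) ⟩
    0                                 ≡⟨ k>n⇒nCk≡0 {0} {suc k} (s≤s z≤n) ⟨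
    0 C suc k                         ≡⟨ ℕP.*-identityˡ (0 C suc k) ⟨
    1 ℕ.* (0 C suc k)                 ∎
    where open ≡-Reasoning
  [1+k]*[1+m]C[1+k]≡[1+m]*mCk (suc m) zero =
    trans (ℕP.+-identityʳ _) (trans (nC1≡n (suc (suc m))) (sym (ℕP.*-identityʳ (suc (suc m)))))
  [1+k]*[1+m]C[1+k]≡[1+m]*mCk (suc m) (suc j) = begin
    suc (suc j) ℕ.* (suc (suc m) C suc (suc j))    ≡⟨ cong (suc (suc j) ℕ.*_) (nCk+nC[k+1]≡[n+1]C[k+1] (suc m) (suc j)) ⟨
    suc (suc j) ℕ.* (a ℕ.+ b)                      ≡⟨ solve 3 (λ j a b → (con 2 :+ j) :* (a :+ b) := a :+ (con 1 :+ j) :* a :+ (con 2 :+ j) :* b) refl j a b ⟩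
    a ℕ.+ suc j ℕ.* a ℕ.+ suc (suc j) ℕ.* b        ≡⟨ cong₂ (λ x y → a ℕ.+ x ℕ.+ y) ([1+k]*[1+m]C[1+k]≡[1+m]*mCk m j) ([1+k]*[1+m]C[1+k]≡[1+m]*mCk m (suc j)) ⟩
    a ℕ.+ suc m ℕ.* c ℕ.+ suc m ℕ.* d              ≡⟨ solve 4 (λ m a c d → a :+ (con 1 :+ m) :* c :+ (con 1 :+ m) :* d := a :+ (con 1 :+ m) :* (c :+ d)) refl m a c d ⟩
    a ℕ.+ suc m ℕ.* (c ℕ.+ d)                      ≡⟨ cong (λ x → a ℕ.+ suc m ℕ.* x) (nCk+nC[k+1]≡[n+1]C[k+1] m j) ⟩
    suc (suc m) ℕ.* a                              ∎
    where
    open ≡-Reasoning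
    a = suc m C suc j
    b = suc m C suc (suc j)
    c = m C j
    d = m C suc j

  central : ℕ → ℕ
  central n = (2 ℕ.* n) C n

  2[1+n]≡2+2n : ∀ n → 2 ℕ.* suc n ≡ suc (suc (2 ℕ.* n))
  2[1+n]≡2+2n n = solve 1 (λ n → con 2 :* (con 1 :+ n) := con 2 :+ con 2 :* n) refl n

  [1+2n]Cn≡[1+2n]C[1+n] : ∀ n → suc (2 ℕ.* n) C n ≡ suc (2 ℕ.* n) C suc n
  [1+2n]Cn≡[1+2n]C[1+n] n =
    trans (nCk≡nC[n∸k] (ℕP.≤-trans (ℕP.m≤m+n n (n ℕ.+ 0)) (ℕP.n≤1+n _))) (cong (suc (2 ℕ.* n) C_) complement)
    where
    complement : suc (2 ℕ.* n) ∸ n ≡ suc n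
    complement = trans (cong (_∸ n) (solve 1 (λ n → con 1 :+ con 2 :* n := (con 1 :+ n) :+ n) refl n))
                       (ℕP.m+n∸n≡m (suc n) n)

  central[1+n]≡2*[1+2n]Cn : ∀ n → central (suc n) ≡ 2 ℕ.* (suc (2 ℕ.* n) C n)
  central[1+n]≡2*[1+2n]Cn n = begin
    (2 ℕ.* suc n) C suc n                             ≡⟨ cong (_C suc n) (2[1+n]≡2+2n n) ⟩
    suc (suc (2 ℕ.* n)) C suc n                       ≡⟨ nCk+nC[k+1]≡[n+1]C[k+1] (suc (2 ℕ.* n)) n ⟨
    (suc (2 ℕ.* n) C n) ℕ.+ (suc (2 ℕ.* n) C suc n)   ≡⟨ cong (λ x → (suc (2 ℕ.* n) C n) ℕ.+ x) ([1+2n]Cn≡[1+2n]C[1+n] n) ⟨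
    (suc (2 ℕ.* n) C n) ℕ.+ (suc (2 ℕ.* n) C n)       ≡⟨ solve 1 (λ x → x :+ x := con 2 :* x) refl (suc (2 ℕ.* n) C n) ⟩
    2 ℕ.* (suc (2 ℕ.* n) C n)                         ∎
    where open ≡-Reasoning

  central-recurrence : ∀ n → suc n ℕ.* central (suc n) ℕ.+ 2 ℕ.* central n ≡ 4 ℕ.* suc n ℕ.* central n
  central-recurrence n = begin
    suc n ℕ.* central (suc n) ℕ.+ 2 ℕ.* b
      ≡⟨ cong (λ x → suc n ℕ.* x ℕ.+ 2 ℕ.* b) (central[1+n]≡2*[1+2n]Cn n) ⟩
    suc n ℕ.* (2 ℕ.* (suc (2 ℕ.* n) C n)) ℕ.+ 2 ℕ.* b
      ≡⟨ cong (λ x → suc n ℕ.* (2 ℕ.* x) ℕ.+ 2 ℕ.* b) ([1+2n]Cn≡[1+2n]C[1+n] n) ⟩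
    suc n ℕ.* (2 ℕ.* a) ℕ.+ 2 ℕ.* b
      ≡⟨ solve 3 (λ n a b → (con 1 :+ n) :* (con 2 :* a) :+ con 2 :* b := con 2 :* ((con 1 :+ n) :* a) :+ con 2 :* b) refl n a b ⟩
    2 ℕ.* (suc n ℕ.* a) ℕ.+ 2 ℕ.* b
      ≡⟨ cong (λ x → 2 ℕ.* x ℕ.+ 2 ℕ.* b) ([1+k]*[1+m]C[1+k]≡[1+m]*mCk (2 ℕ.* n) n) ⟩
    2 ℕ.* (suc (2 ℕ.* n) ℕ.* b) ℕ.+ 2 ℕ.* b
      ≡⟨ solve 2 (λ n b → con 2 :* ((con 1 :+ con 2 :* n) :* b) :+ con 2 :* b := con 4 :* (con 1 :+ n) :* b) refl n b ⟩
    4 ℕ.* suc n ℕ.* b ∎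
    where
    open ≡-Reasoning
    a = suc (2 ℕ.* n) C suc n
    b = central n

  derCatBinomial : ℕ → ℕ → ℕ
  derCatBinomial n k = (2 ℕ.* n ∸ k) C (n ∸ k)

  derCatBinomial-pascal : ∀ m k → suc k ≤ m →
    derCatBinomial (suc m) (suc k) ≡ derCatBinomial m k ℕ.+ derCatBinomial (suc m) (suc (suc k))
  derCatBinomial-pascal m k k<m = begin
    (2 ℕ.* suc m ∸ suc k) C (m ∸ k)        ≡⟨ cong₂ _C_ top≡1+N (ℕP.+-∸-assoc 1 k<m) ⟩
    suc N C suc r                          ≡⟨ nCk+nC[k+1]≡[n+1]C[k+1] N r ⟨
    (N C r) ℕ.+ (N C suc r)                ≡⟨ ℕP.+-comm (N C r) (N C suc r) ⟩
    (N C suc r) ℕ.+ (N C r)                ≡⟨ cong₂ (λ a b → (N C a) ℕ.+ (b C r)) (sym (ℕP.+-∸-assoc 1 k<m)) (sym (cong (_∸ suc (suc k)) (2[1+n]≡2+2n m))) ⟩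
    (N C (m ∸ k)) ℕ.+ ((2 ℕ.* suc m ∸ suc (suc k)) C r) ∎
    where
    open ≡-Reasoning
    N = 2 ℕ.* m ∸ k
    r = m ∸ suc k
    k≤2m : k ≤ 2 ℕ.* m
    k≤2m = ℕP.≤-trans (ℕP.≤-trans (ℕP.n≤1+n k) k<m) (ℕP.m≤m+n m (m ℕ.+ 0))
    top≡1+N : 2 ℕ.* suc m ∸ suc k ≡ suc N
    top≡1+N = trans (cong (_∸ suc k) (2[1+n]≡2+2n m)) (ℕP.+-∸-assoc 1 k≤2m)

open +-*-Solver

ι≡mkℚ : ∀ n → ι n ≡ mkℚ (+ n) 0 (Coprime.sym (Coprime.1-coprimeTo n))
ι≡mkℚ n = ℚP.normalize-coprime _

ι-homo-+ : ∀ m n → ι (m ℕ.+ n) ≡ ι m + ι n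
ι-homo-+ m n rewrite ι≡mkℚ m | ι≡mkℚ n =
  cong (_/ 1) (cong₂ ℤ._+_ (sym (ℤP.*-identityʳ (+ m))) (sym (ℤP.*-identityʳ (+ n))))

ι-homo-* : ∀ m n → ι (m ℕ.* n) ≡ ι m * ι n
ι-homo-* m n rewrite ι≡mkℚ m | ι≡mkℚ n = cong (_/ 1) (ℤP.pos-* m n)

*-cancelˡ-≡ : ∀ p {x y} .{{_ : NonZero p}} → p * x ≡ p * y → x ≡ y
*-cancelˡ-≡ p {x} {y} eq = begin
  x              ≡⟨ sym (ℚP.*-identityˡ x) ⟩
  1ℚ * x         ≡⟨ cong (_* x) (sym (ℚP.*-inverseˡ p)) ⟩
  (1/ p * p) * x ≡⟨ ℚP.*-assoc (1/ p) p x ⟩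
  1/ p * (p * x) ≡⟨ cong (1/ p *_) eq ⟩
  1/ p * (p * y) ≡⟨ ℚP.*-assoc (1/ p) p y ⟨
  (1/ p * p) * y ≡⟨ cong (_* y) (ℚP.*-inverseˡ p) ⟩
  1ℚ * y         ≡⟨ ℚP.*-identityˡ y ⟩
  y              ∎
  where open ≡-Reasoning

ι-suc-*-cancelˡ : ∀ n {x y} → ι (suc n) * x ≡ ι (suc n) * y → x ≡ y
ι-suc-*-cancelˡ n eq rewrite ι≡mkℚ (suc n) = *-cancelˡ-≡ (mkℚ (+ suc n) 0 _) eq

ι[1+n]*[m/1+n]≡ιm : ∀ n m → ι (suc n) * (+ m / suc n) ≡ ι m
ι[1+n]*[m/1+n]≡ιm n m = ℚP.toℚᵘ-injective (begin
  toℚᵘ (ι (suc n) * (+ m / suc n))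
    ≈⟨ ℚP.toℚᵘ-homo-* (ι (suc n)) (+ m / suc n) ⟩
  toℚᵘ (ι (suc n)) ℚᵘ.* toℚᵘ (+ m / suc n)
    ≈⟨ ℚᵘP.*-cong (ℚP.toℚᵘ-fromℚᵘ (ℚᵘ.mkℚᵘ (+ suc n) 0)) (ℚP.toℚᵘ-fromℚᵘ (ℚᵘ.mkℚᵘ (+ m) n)) ⟩
  ℚᵘ.mkℚᵘ (+ suc n) 0 ℚᵘ.* ℚᵘ.mkℚᵘ (+ m) n
    ≈⟨ ℚᵘ.*≡* cross ⟩
  ℚᵘ.mkℚᵘ (+ m) 0
    ≈⟨ ℚP.toℚᵘ-fromℚᵘ (ℚᵘ.mkℚᵘ (+ m) 0) ⟨
  toℚᵘ (ι m) ∎)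
  where
  open ℚᵘP.≃-Reasoning
  cross : (+ suc n ℤ.* + m) ℤ.* + 1 ≡ + m ℤ.* + suc (n ℕ.+ 0)
  cross = trans (ℤP.*-identityʳ _)
    (trans (ℤP.*-comm (+ suc n) (+ m)) (cong (λ k → + m ℤ.* + suc k) (sym (ℕP.+-identityʳ n))))

sumTo-cong : ∀ n {f g : ℕ → ℚ} → (∀ i → i ≤ n → f i ≡ g i) → sumTo n f ≡ sumTo n g
sumTo-cong zero    eq = eq 0 z≤n
sumTo-cong (suc n) eq =
  cong₂ _+_ (sumTo-cong n (λ i i≤n → eq i (ℕP.m≤n⇒m≤1+n i≤n))) (eq (suc n) ℕP.≤-refl)

sumTo-cong′ : ∀ n {f g : ℕ → ℚ} → (∀ i → f i ≡ g i) → sumTo n f ≡ sumTo n g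
sumTo-cong′ n eq = sumTo-cong n (λ i _ → eq i)

sumTo-+ : ∀ n (f g : ℕ → ℚ) → sumTo n (λ i → f i + g i) ≡ sumTo n f + sumTo n g
sumTo-+ zero    f g = refl
sumTo-+ (suc n) f g = begin
  sumTo n (λ i → f i + g i) + (f (suc n) + g (suc n))
    ≡⟨ cong (_+ (f (suc n) + g (suc n))) (sumTo-+ n f g) ⟩
  (sumTo n f + sumTo n g) + (f (suc n) + g (suc n))
    ≡⟨ solve 4 (λ a b c d → (a :+ b) :+ (c :+ d) := (a :+ c) :+ (b :+ d)) refl
         (sumTo n f) (sumTo n g) (f (suc n)) (g (suc n)) ⟩
  (sumTo n f + f (suc n)) + (sumTo n g + g (suc n)) ∎
  where open ≡-Reasoning

sumTo-*ˡ : ∀ n c (f : ℕ → ℚ) → sumTo n (λ i → c * f i) ≡ c * sumTo n f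
sumTo-*ˡ zero    c f = refl
sumTo-*ˡ (suc n) c f =
  trans (cong (_+ c * f (suc n)) (sumTo-*ˡ n c f)) (sym (ℚP.*-distribˡ-+ c (sumTo n f) (f (suc n))))

sumTo-*ʳ : ∀ n c (f : ℕ → ℚ) → sumTo n (λ i → f i * c) ≡ sumTo n f * c
sumTo-*ʳ n c f = trans (sumTo-cong′ n (λ i → ℚP.*-comm (f i) c)) (trans (sumTo-*ˡ n c f) (ℚP.*-comm c _))

sumTo-neg : ∀ n (f : ℕ → ℚ) → sumTo n (λ i → - f i) ≡ - sumTo n f
sumTo-neg zero    f = refl
sumTo-neg (suc n) f =
  trans (cong (_+ - f (suc n)) (sumTo-neg n f)) (sym (ℚP.neg-distrib-+ (sumTo n f) (f (suc n))))

sumTo-- : ∀ n (f g : ℕ → ℚ) → sumTo n (λ i → f i - g i) ≡ sumTo n f - sumTo n g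
sumTo-- n f g = trans (sumTo-+ n f (λ i → - g i)) (cong (λ s → sumTo n f + s) (sumTo-neg n g))

sumTo-zero : ∀ n (f : ℕ → ℚ) → (∀ i → i ≤ n → f i ≡ 0ℚ) → sumTo n f ≡ 0ℚ
sumTo-zero n f f≡0 = trans (sumTo-cong n f≡0) (sumTo-const0 n)
  where
  sumTo-const0 : ∀ n → sumTo n (λ _ → 0ℚ) ≡ 0ℚ
  sumTo-const0 zero    = refl
  sumTo-const0 (suc n) = cong (_+ 0ℚ) (sumTo-const0 n)

sumTo-sucˡ : ∀ n (f : ℕ → ℚ) → sumTo (suc n) f ≡ f 0 + sumTo n (λ i → f (suc i))
sumTo-sucˡ zero    f = refl
sumTo-sucˡ (suc n) f = trans (cong (_+ f (suc (suc n))) (sumTo-sucˡ n f)) (ℚP.+-assoc (f 0) _ _)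

sumTo-reverse : ∀ n (f : ℕ → ℚ) → sumTo n f ≡ sumTo n (λ i → f (n ∸ i))
sumTo-reverse zero    f = refl
sumTo-reverse (suc n) f = begin
  sumTo n f + f (suc n)                   ≡⟨ ℚP.+-comm (sumTo n f) (f (suc n)) ⟩
  f (suc n) + sumTo n f                   ≡⟨ cong (λ s → f (suc n) + s) (sumTo-reverse n f) ⟩
  f (suc n) + sumTo n (λ i → f (n ∸ i))   ≡⟨ sumTo-sucˡ n (λ i → f (suc n ∸ i)) ⟨
  sumTo (suc n) (λ i → f (suc n ∸ i))     ∎
  where open ≡-Reasoning

sumTo-single : ∀ n k (f : ℕ → ℚ) → k ≤ n → (∀ i → i ≤ n → i ≢ k → f i ≡ 0ℚ) → sumTo n f ≡ f k
sumTo-single zero .zero f z≤n _ = refl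
sumTo-single (suc n) k f k≤1+n f≡0 with k ℕP.≟ suc n
... | yes refl = trans (cong (_+ f (suc n)) (sumTo-zero n f below)) (ℚP.+-identityˡ _)
  where
  below : ∀ i → i ≤ n → f i ≡ 0ℚ
  below i i≤n = f≡0 i (ℕP.m≤n⇒m≤1+n i≤n) (λ { refl → ℕP.1+n≰n i≤n })
... | no k≢1+n = trans (cong₂ _+_ rest (f≡0 (suc n) ℕP.≤-refl (k≢1+n ∘ sym))) (ℚP.+-identityʳ _)
  where
  rest : sumTo n f ≡ f k
  rest = sumTo-single n k f (ℕP.≤-pred (ℕP.≤∧≢⇒< k≤1+n k≢1+n)) (λ i i≤n → f≡0 i (ℕP.m≤n⇒m≤1+n i≤n))

sumTo-extend : ∀ m n (f : ℕ → ℚ) → m ≤ n → (∀ i → m < i → f i ≡ 0ℚ) → sumTo n f ≡ sumTo m f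
sumTo-extend m n f m≤n f≡0 = trans (cong (λ k → sumTo k f) (sym (ℕP.m∸n+n≡m m≤n))) (extend (n ∸ m))
  where
  extend : ∀ d → sumTo (d ℕ.+ m) f ≡ sumTo m f
  extend zero    = refl
  extend (suc d) =
    trans (cong₂ _+_ (extend d) (f≡0 (suc (d ℕ.+ m)) (s≤s (ℕP.m≤n+m m d)))) (ℚP.+-identityʳ _)

sumTo-swap : ∀ n m (F : ℕ → ℕ → ℚ) →
             sumTo n (λ i → sumTo m (F i)) ≡ sumTo m (λ j → sumTo n (λ i → F i j))
sumTo-swap zero    m F = refl
sumTo-swap (suc n) m F =
  trans (cong (_+ sumTo m (F (suc n))) (sumTo-swap n m F)) (sym (sumTo-+ m _ (F (suc n))))

sumTo-triangle : ∀ n (F : ℕ → ℕ → ℚ) →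
                 sumTo n (λ i → sumTo i (F i)) ≡ sumTo n (λ j → sumTo (n ∸ j) (λ k → F (j ℕ.+ k) j))
sumTo-triangle zero    F = refl
sumTo-triangle (suc n) F = begin
  sumTo n (λ i → sumTo i (F i)) + (sumTo n (F (suc n)) + F (suc n) (suc n))
    ≡⟨ cong (λ s → s + (sumTo n (F (suc n)) + F (suc n) (suc n))) (sumTo-triangle n F) ⟩
  Inner n + (sumTo n (F (suc n)) + F (suc n) (suc n))
    ≡⟨ ℚP.+-assoc (Inner n) (sumTo n (F (suc n))) (F (suc n) (suc n)) ⟨
  (Inner n + sumTo n (F (suc n))) + F (suc n) (suc n)
    ≡⟨ cong₂ _+_ (sym (sumTo-+ n _ _)) (cong (λ z → F z (suc n)) (sym (ℕP.+-identityʳ (suc n)))) ⟩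
  sumTo n (λ j → sumTo (n ∸ j) (λ k → F (j ℕ.+ k) j) + F (suc n) j) + F (suc n ℕ.+ 0) (suc n)
    ≡⟨ cong₂ _+_ (sumTo-cong n column-step) (cong (λ d → sumTo d (λ k → F (suc n ℕ.+ k) (suc n))) (sym (ℕP.n∸n≡0 n))) ⟩
  Inner (suc n) ∎
  where
  open ≡-Reasoning
  Inner : ℕ → ℚ
  Inner m = sumTo m (λ j → sumTo (m ∸ j) (λ k → F (j ℕ.+ k) j))
  column-step : ∀ j → j ≤ n →
    sumTo (n ∸ j) (λ k → F (j ℕ.+ k) j) + F (suc n) j ≡ sumTo (suc n ∸ j) (λ k → F (j ℕ.+ k) j)
  column-step j j≤n rewrite ℕP.+-∸-assoc 1 j≤n =
    cong (λ z → sumTo (n ∸ j) (λ k → F (j ℕ.+ k) j) + F z j)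
         (sym (trans (ℕP.+-suc j (n ∸ j)) (cong suc (ℕP.m+[n∸m]≡n j≤n))))

sumTo-*-one : ∀ n (f : ℕ → ℚ) → sumTo n (λ j → f j * one j) ≡ f 0
sumTo-*-one zero    f = ℚP.*-identityʳ (f 0)
sumTo-*-one (suc n) f = trans (cong₂ _+_ (sumTo-*-one n f) (ℚP.*-zeroʳ (f (suc n)))) (ℚP.+-identityʳ _)

0ₛ : Series
0ₛ _ = 0ℚ

≈ₛ-setoid : Setoid _ _
≈ₛ-setoid = record
  { Carrier       = Series
  ; _≈_           = _≈ₛ_
  ; isEquivalence = record
    { refl  = λ _ → refl
    ; sym   = λ f≈g n → sym (f≈g n)
    ; trans = λ f≈g g≈h n → trans (f≈g n) (g≈h n)
    }
  }

open Setoid ≈ₛ-setoid using () renaming (refl to ≈ₛ-refl; sym to ≈ₛ-sym; trans to ≈ₛ-trans)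
module ≈ₛ-Reasoning = SetoidReasoning ≈ₛ-setoid

⊖≈0ₛ⇒≈ : ∀ {f g} → (f ⊖ g) ≈ₛ 0ₛ → f ≈ₛ g
⊖≈0ₛ⇒≈ {f} {g} f-g≈0 n = x-y≡0⇒x≡y (f n) (g n) (f-g≈0 n)

⊛-cong : ∀ {f f′ g g′} → f ≈ₛ f′ → g ≈ₛ g′ → (f ⊛ g) ≈ₛ (f′ ⊛ g′)
⊛-cong f≈f′ g≈g′ n = sumTo-cong′ n (λ i → cong₂ _*_ (f≈f′ i) (g≈g′ (n ∸ i)))

⊛-congˡ : ∀ {f f′} g → f ≈ₛ f′ → (f ⊛ g) ≈ₛ (f′ ⊛ g)
⊛-congˡ g f≈f′ = ⊛-cong f≈f′ (≈ₛ-refl {g})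

⊛-congʳ : ∀ f {g g′} → g ≈ₛ g′ → (f ⊛ g) ≈ₛ (f ⊛ g′)
⊛-congʳ f = ⊛-cong (≈ₛ-refl {f})

⊕-cong : ∀ {f f′ g g′} → f ≈ₛ f′ → g ≈ₛ g′ → (f ⊕ g) ≈ₛ (f′ ⊕ g′)
⊕-cong f≈f′ g≈g′ n = cong₂ _+_ (f≈f′ n) (g≈g′ n)

⊖-cong : ∀ {f f′ g g′} → f ≈ₛ f′ → g ≈ₛ g′ → (f ⊖ g) ≈ₛ (f′ ⊖ g′)
⊖-cong f≈f′ g≈g′ n = cong₂ _-_ (f≈f′ n) (g≈g′ n)

·-congʳ : ∀ c {f f′} → f ≈ₛ f′ → (c · f) ≈ₛ (c · f′)
·-congʳ c f≈f′ n = cong (c *_) (f≈f′ n)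

⊛-comm : ∀ f g → (f ⊛ g) ≈ₛ (g ⊛ f)
⊛-comm f g n = trans (sumTo-reverse n _) (sumTo-cong n swap)
  where
  swap : ∀ i → i ≤ n → f (n ∸ i) * g (n ∸ (n ∸ i)) ≡ g i * f (n ∸ i)
  swap i i≤n = trans (ℚP.*-comm (f (n ∸ i)) _) (cong (λ j → g j * f (n ∸ i)) (ℕP.m∸[m∸n]≡n i≤n))

⊛-assoc : ∀ f g h → ((f ⊛ g) ⊛ h) ≈ₛ (f ⊛ (g ⊛ h))
⊛-assoc f g h n = begin
  sumTo n (λ i → sumTo i (λ j → f j * g (i ∸ j)) * h (n ∸ i))
    ≡⟨ sumTo-cong′ n (λ i → sym (sumTo-*ʳ i (h (n ∸ i)) _)) ⟩
  sumTo n (λ i → sumTo i (λ j → f j * g (i ∸ j) * h (n ∸ i)))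
    ≡⟨ sumTo-triangle n (λ i j → f j * g (i ∸ j) * h (n ∸ i)) ⟩
  sumTo n (λ j → sumTo (n ∸ j) (λ k → f j * g ((j ℕ.+ k) ∸ j) * h (n ∸ (j ℕ.+ k))))
    ≡⟨ sumTo-cong′ n (λ j → trans (sumTo-cong′ (n ∸ j) (reindex j)) (sumTo-*ˡ (n ∸ j) (f j) _)) ⟩
  sumTo n (λ j → f j * sumTo (n ∸ j) (λ k → g k * h ((n ∸ j) ∸ k))) ∎
  where
  open ≡-Reasoning
  reindex : ∀ j k → f j * g ((j ℕ.+ k) ∸ j) * h (n ∸ (j ℕ.+ k)) ≡ f j * (g k * h ((n ∸ j) ∸ k))
  reindex j k = trans (cong₂ (λ a b → f j * g a * h b) (ℕP.m+n∸m≡n j k) (sym (ℕP.∸-+-assoc n j k)))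
                      (ℚP.*-assoc (f j) (g k) _)

⊛-distribʳ-⊕ : ∀ f g k → ((f ⊕ g) ⊛ k) ≈ₛ ((f ⊛ k) ⊕ (g ⊛ k))
⊛-distribʳ-⊕ f g k n = trans (sumTo-cong′ n (λ i → ℚP.*-distribʳ-+ (k (n ∸ i)) (f i) (g i))) (sumTo-+ n _ _)

⊛-distribʳ-⊖ : ∀ f g k → ((f ⊖ g) ⊛ k) ≈ₛ ((f ⊛ k) ⊖ (g ⊛ k))
⊛-distribʳ-⊖ f g k n = trans (sumTo-cong′ n distrib) (sumTo-- n _ _)
  where
  distrib : ∀ i → (f i - g i) * k (n ∸ i) ≡ f i * k (n ∸ i) - g i * k (n ∸ i)
  distrib i = solve 3 (λ a b c → (a :- b) :* c := a :* c :- b :* c) refl (f i) (g i) (k (n ∸ i))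

⊛-distribˡ-⊕ : ∀ k f g → (k ⊛ (f ⊕ g)) ≈ₛ ((k ⊛ f) ⊕ (k ⊛ g))
⊛-distribˡ-⊕ k f g =
  ≈ₛ-trans (⊛-comm k (f ⊕ g)) (≈ₛ-trans (⊛-distribʳ-⊕ f g k) (⊕-cong (⊛-comm f k) (⊛-comm g k)))

⊛-distribˡ-⊖ : ∀ k f g → (k ⊛ (f ⊖ g)) ≈ₛ ((k ⊛ f) ⊖ (k ⊛ g))
⊛-distribˡ-⊖ k f g =
  ≈ₛ-trans (⊛-comm k (f ⊖ g)) (≈ₛ-trans (⊛-distribʳ-⊖ f g k) (⊖-cong (⊛-comm f k) (⊛-comm g k)))

⊛-·ˡ : ∀ c f g → ((c · f) ⊛ g) ≈ₛ (c · (f ⊛ g))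
⊛-·ˡ c f g n = trans (sumTo-cong′ n (λ i → ℚP.*-assoc c (f i) (g (n ∸ i)))) (sumTo-*ˡ n c _)

⊛-·ʳ : ∀ c f g → (f ⊛ (c · g)) ≈ₛ (c · (f ⊛ g))
⊛-·ʳ c f g = ≈ₛ-trans (⊛-comm f (c · g)) (≈ₛ-trans (⊛-·ˡ c g f) (·-congʳ c (⊛-comm g f)))

⊛-identityʳ : ∀ f → (f ⊛ one) ≈ₛ f
⊛-identityʳ f n = trans (sumTo-reverse n _) (trans (sumTo-cong n flip) (sumTo-*-one n (λ i → f (n ∸ i))))
  where
  flip : ∀ i → i ≤ n → f (n ∸ i) * one (n ∸ (n ∸ i)) ≡ f (n ∸ i) * one i
  flip i i≤n = cong (λ j → f (n ∸ i) * one j) (ℕP.m∸[m∸n]≡n i≤n)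

⊛-identityˡ : ∀ f → (one ⊛ f) ≈ₛ f
⊛-identityˡ f = ≈ₛ-trans (⊛-comm one f) (⊛-identityʳ f)

X⊛f[0]≡0 : ∀ f → (X ⊛ f) 0 ≡ 0ℚ
X⊛f[0]≡0 f = ℚP.*-zeroˡ (f 0)

X⊛f[1+n]≡f[n] : ∀ f n → (X ⊛ f) (suc n) ≡ f n
X⊛f[1+n]≡f[n] f n = begin
  (X ⊛ f) (suc n)             ≡⟨ sumTo-sucˡ n _ ⟩
  0ℚ * f (suc n) + (one ⊛ f) n ≡⟨ cong (_+ (one ⊛ f) n) (ℚP.*-zeroˡ (f (suc n))) ⟩
  0ℚ + (one ⊛ f) n            ≡⟨ ℚP.+-identityˡ _ ⟩
  (one ⊛ f) n                 ≡⟨ ⊛-identityˡ f n ⟩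
  f n                         ∎
  where open ≡-Reasoning

pow-cong : ∀ {h h′} → h ≈ₛ h′ → ∀ k → pow h k ≈ₛ pow h′ k
pow-cong h≈h′ zero    = ≈ₛ-refl
pow-cong h≈h′ (suc k) = ⊛-cong h≈h′ (pow-cong h≈h′ k)

deriv-⊛ : ∀ f g → deriv (f ⊛ g) ≈ₛ ((deriv f ⊛ g) ⊕ (f ⊛ deriv g))
deriv-⊛ f g n = begin
  ι (suc n) * sumTo (suc n) (λ i → f i * g (suc n ∸ i))
    ≡⟨ sumTo-*ˡ (suc n) (ι (suc n)) _ ⟨
  sumTo (suc n) (λ i → ι (suc n) * (f i * g (suc n ∸ i)))
    ≡⟨ sumTo-cong (suc n) split ⟩
  sumTo (suc n) (λ i → ι i * (f i * g (suc n ∸ i)) + ι (suc n ∸ i) * (f i * g (suc n ∸ i)))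
    ≡⟨ sumTo-+ (suc n) _ _ ⟩
  sumTo (suc n) (λ i → ι i * (f i * g (suc n ∸ i))) + sumTo (suc n) (λ i → ι (suc n ∸ i) * (f i * g (suc n ∸ i)))
    ≡⟨ cong₂ _+_ left right ⟩
  (deriv f ⊛ g) n + (f ⊛ deriv g) n ∎
  where
  open ≡-Reasoning
  split : ∀ i → i ≤ suc n →
          ι (suc n) * (f i * g (suc n ∸ i)) ≡ ι i * (f i * g (suc n ∸ i)) + ι (suc n ∸ i) * (f i * g (suc n ∸ i))
  split i i≤ = begin
    ι (suc n) * t                      ≡⟨ cong (λ m → ι m * t) (ℕP.m+[n∸m]≡n i≤) ⟨
    ι (i ℕ.+ (suc n ∸ i)) * t          ≡⟨ cong (_* t) (ι-homo-+ i (suc n ∸ i)) ⟩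
    (ι i + ι (suc n ∸ i)) * t          ≡⟨ ℚP.*-distribʳ-+ t (ι i) (ι (suc n ∸ i)) ⟩
    ι i * t + ι (suc n ∸ i) * t        ∎
    where t = f i * g (suc n ∸ i)
  left : sumTo (suc n) (λ i → ι i * (f i * g (suc n ∸ i))) ≡ (deriv f ⊛ g) n
  left = begin
    sumTo (suc n) (λ i → ι i * (f i * g (suc n ∸ i)))
      ≡⟨ sumTo-sucˡ n _ ⟩
    0ℚ * (f 0 * g (suc n)) + sumTo n (λ i → ι (suc i) * (f (suc i) * g (n ∸ i)))
      ≡⟨ cong (_+ sumTo n (λ i → ι (suc i) * (f (suc i) * g (n ∸ i)))) (ℚP.*-zeroˡ (f 0 * g (suc n))) ⟩
    0ℚ + sumTo n (λ i → ι (suc i) * (f (suc i) * g (n ∸ i)))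
      ≡⟨ ℚP.+-identityˡ (sumTo n (λ i → ι (suc i) * (f (suc i) * g (n ∸ i)))) ⟩
    sumTo n (λ i → ι (suc i) * (f (suc i) * g (n ∸ i)))
      ≡⟨ sumTo-cong′ n (λ i → sym (ℚP.*-assoc (ι (suc i)) (f (suc i)) (g (n ∸ i)))) ⟩
    (deriv f ⊛ g) n ∎
  last : ι (suc n ∸ suc n) * (f (suc n) * g (suc n ∸ suc n)) ≡ 0ℚ
  last = trans (cong (λ m → ι m * (f (suc n) * g m)) (ℕP.n∸n≡0 n)) (ℚP.*-zeroˡ (f (suc n) * g 0))
  shuffle : ∀ i → i ≤ n → ι (suc n ∸ i) * (f i * g (suc n ∸ i)) ≡ f i * deriv g (n ∸ i)
  shuffle i i≤n = trans (cong (λ m → ι m * (f i * g m)) (ℕP.+-∸-assoc 1 i≤n))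
    (solve 3 (λ a b c → a :* (b :* c) := b :* (a :* c)) refl (ι (suc (n ∸ i))) (f i) (g (suc (n ∸ i))))
  right : sumTo (suc n) (λ i → ι (suc n ∸ i) * (f i * g (suc n ∸ i))) ≡ (f ⊛ deriv g) n
  right = trans (cong (λ s → front + s) last) (trans (ℚP.+-identityʳ front) (sumTo-cong n shuffle))
    where front = sumTo n (λ i → ι (suc n ∸ i) * (f i * g (suc n ∸ i)))

deriv-⊖ : ∀ f g → deriv (f ⊖ g) ≈ₛ (deriv f ⊖ deriv g)
deriv-⊖ f g n = solve 3 (λ a x y → a :* (x :- y) := a :* x :- a :* y) refl (ι (suc n)) (f (suc n)) (g (suc n))

VanishesBelow : ℕ → Series → Set
VanishesBelow a f = ∀ i → i < a → f i ≡ 0ℚ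

vanishesBelow-suc : ∀ {n f} → VanishesBelow n f → f n ≡ 0ℚ → VanishesBelow (suc n) f
vanishesBelow-suc {n} f<n≡0 fn≡0 i i<1+n with ℕP.m<1+n⇒m<n∨m≡n i<1+n
... | inj₁ i<n  = f<n≡0 i i<n
... | inj₂ refl = fn≡0

≈0ₛ-by-induction : ∀ f → (∀ n → VanishesBelow n f → f n ≡ 0ℚ) → f ≈ₛ 0ₛ
≈0ₛ-by-induction f step n = below (suc n) n ℕP.≤-refl
  where
  below : ∀ m → VanishesBelow m f
  below zero    i ()
  below (suc m) = vanishesBelow-suc (below m) (step m (below m))

n∸i<b : ∀ {n i b} → i ≤ n → n < i ℕ.+ b → n ∸ i < b
n∸i<b {n} {i} {b} i≤n n<i+b =
  ℕP.+-cancelˡ-< i (n ∸ i) b (subst (_< i ℕ.+ b) (sym (ℕP.m+[n∸m]≡n i≤n)) n<i+b)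

*-vanishes : ∀ {a b f g} → VanishesBelow a f → VanishesBelow b g →
             ∀ i j → i < a ⊎ j < b → f i * g j ≡ 0ℚ
*-vanishes {f = f} {g} f<a≡0 g<b≡0 i j (inj₁ i<a) = trans (cong (_* g j) (f<a≡0 i i<a)) (ℚP.*-zeroˡ (g j))
*-vanishes {f = f} {g} f<a≡0 g<b≡0 i j (inj₂ j<b) = trans (cong (f i *_) (g<b≡0 j j<b)) (ℚP.*-zeroʳ (f i))

vanishesBelow-⊛ : ∀ a b {f g} → VanishesBelow a f → VanishesBelow b g → VanishesBelow (a ℕ.+ b) (f ⊛ g)
vanishesBelow-⊛ a b f<a≡0 g<b≡0 n n<a+b = sumTo-zero n _ term≡0
  where
  term≡0 : ∀ i → i ≤ n → _
  term≡0 i i≤n = *-vanishes f<a≡0 g<b≡0 i (n ∸ i) early-or-late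
    where
    early-or-late : i < a ⊎ n ∸ i < b
    early-or-late with i ℕP.<? a
    ... | yes i<a = inj₁ i<a
    ... | no  i≮a = inj₂ (n∸i<b i≤n (ℕP.<-≤-trans n<a+b (ℕP.+-monoˡ-≤ b (ℕP.≮⇒≥ i≮a))))

vanishesBelow-pow : ∀ {h} → VanishesBelow 1 h → ∀ k → VanishesBelow k (pow h k)
vanishesBelow-pow h₀≡0 zero    i ()
vanishesBelow-pow h₀≡0 (suc k) = vanishesBelow-⊛ 1 k h₀≡0 (vanishesBelow-pow h₀≡0 k)

⊛-leading : ∀ a b {f g} → VanishesBelow a f → VanishesBelow b g → (f ⊛ g) (a ℕ.+ b) ≡ f a * g b
⊛-leading a b {f} {g} f<a≡0 g<b≡0 =
  trans (sumTo-single (a ℕ.+ b) a _ (ℕP.m≤m+n a b) term≡0) (cong (λ j → f a * g j) (ℕP.m+n∸m≡n a b))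
  where
  term≡0 : ∀ i → i ≤ a ℕ.+ b → i ≢ a → f i * g (a ℕ.+ b ∸ i) ≡ 0ℚ
  term≡0 i i≤a+b i≢a = *-vanishes f<a≡0 g<b≡0 i (a ℕ.+ b ∸ i) early-or-late
    where
    early-or-late : i < a ⊎ a ℕ.+ b ∸ i < b
    early-or-late with i ℕP.<? a
    ... | yes i<a = inj₁ i<a
    ... | no  i≮a = inj₂ (n∸i<b i≤a+b (ℕP.+-monoˡ-< b (ℕP.≤∧≢⇒< (ℕP.≮⇒≥ i≮a) (i≢a ∘ sym))))

pow-diagonal : ∀ {h} → VanishesBelow 1 h → h 1 ≡ 1ℚ → ∀ k → pow h k k ≡ 1ℚ
pow-diagonal h₀≡0 h₁≡1 zero    = refl
pow-diagonal h₀≡0 h₁≡1 (suc k) =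
  trans (⊛-leading 1 k h₀≡0 (vanishesBelow-pow h₀≡0 k))
        (trans (cong₂ _*_ h₁≡1 (pow-diagonal h₀≡0 h₁≡1 k)) (ℚP.*-identityˡ 1ℚ))

⊛-unit-leading : ∀ a {f} n → VanishesBelow n f → (a ⊛ f) n ≡ a 0 * f n
⊛-unit-leading a n f<n≡0 = ⊛-leading 0 n {a} (λ _ ()) f<n≡0

⊛≈0ₛ⇒≈0ₛ : ∀ {a f} → a 0 ≡ 1ℚ → (f ⊛ a) ≈ₛ 0ₛ → f ≈ₛ 0ₛ
⊛≈0ₛ⇒≈0ₛ {a} {f} a₀≡1 fa≈0 = ≈0ₛ-by-induction f step
  where
  step : ∀ n → VanishesBelow n f → f n ≡ 0ℚ
  step n f<n≡0 = begin
    f n           ≡⟨ ℚP.*-identityˡ (f n) ⟨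
    1ℚ * f n      ≡⟨ cong (_* f n) a₀≡1 ⟨
    a 0 * f n     ≡⟨ ⊛-unit-leading a n f<n≡0 ⟨
    (a ⊛ f) n     ≡⟨ ⊛-comm a f n ⟩
    (f ⊛ a) n     ≡⟨ fa≈0 n ⟩
    0ℚ            ∎
    where open ≡-Reasoning

⊛-cancelʳ : ∀ {a f g} → a 0 ≡ 1ℚ → (f ⊛ a) ≈ₛ (g ⊛ a) → f ≈ₛ g
⊛-cancelʳ {a} {f} {g} a₀≡1 fa≈ga = ⊖≈0ₛ⇒≈ (⊛≈0ₛ⇒≈0ₛ {a} {f ⊖ g} a₀≡1 [f-g]a≈0)
  where
  [f-g]a≈0 : ((f ⊖ g) ⊛ a) ≈ₛ 0ₛ
  [f-g]a≈0 n = trans (⊛-distribʳ-⊖ f g a n) (trans (cong (_- (g ⊛ a) n) (fa≈ga n)) (ℚP.+-inverseʳ ((g ⊛ a) n)))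

linear-ODE-uniqueness : ∀ {a b g} → a 0 ≡ 1ℚ → (a ⊛ deriv g) ≈ₛ (b ⊛ g) → g 0 ≡ 0ℚ → g ≈ₛ 0ₛ
linear-ODE-uniqueness {a} {b} {g} a₀≡1 ode g₀≡0 = ≈0ₛ-by-induction g step
  where
  step : ∀ n → VanishesBelow n g → g n ≡ 0ℚ
  step zero    _        = g₀≡0
  step (suc m) g<1+m≡0 = ι-suc-*-cancelˡ m (begin
    ι (suc m) * g (suc m)  ≡⟨ ℚP.*-identityˡ (deriv g m) ⟨
    1ℚ * deriv g m         ≡⟨ cong (_* deriv g m) a₀≡1 ⟨
    a 0 * deriv g m        ≡⟨ ⊛-unit-leading a m g′<m≡0 ⟨
    (a ⊛ deriv g) m        ≡⟨ ode m ⟩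
    (b ⊛ g) m              ≡⟨ vanishesBelow-⊛ 0 (suc m) {b} {g} (λ _ ()) g<1+m≡0 m ℕP.≤-refl ⟩
    0ℚ                     ≡⟨ ℚP.*-zeroʳ (ι (suc m)) ⟨
    ι (suc m) * 0ℚ         ∎)
    where
    open ≡-Reasoning
    g′<m≡0 : VanishesBelow m (deriv g)
    g′<m≡0 j j<m = trans (cong (ι (suc j) *_) (g<1+m≡0 (suc j) (s≤s j<m))) (ℚP.*-zeroʳ (ι (suc j)))

⊛-square-injective : ∀ {p q} → p 0 ≡ 1ℚ → q 0 ≡ 1ℚ → (p ⊛ p) ≈ₛ (q ⊛ q) → p ≈ₛ q
⊛-square-injective {p} {q} p₀≡1 q₀≡1 pp≈qq = ⊖≈0ₛ⇒≈ (⊛≈0ₛ⇒≈0ₛ {mean} {p ⊖ q} mean₀≡1 [p-q]mean≈0)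
  where
  mean : Series
  mean = ½ · (p ⊕ q)
  mean₀≡1 : mean 0 ≡ 1ℚ
  mean₀≡1 = cong₂ (λ x y → ½ * (x + y)) p₀≡1 q₀≡1
  [p-q]mean≈0 : ((p ⊖ q) ⊛ mean) ≈ₛ 0ₛ
  [p-q]mean≈0 n = begin
    ((p ⊖ q) ⊛ mean) n
      ≡⟨ ⊛-·ʳ ½ (p ⊖ q) (p ⊕ q) n ⟩
    ½ * ((p ⊖ q) ⊛ (p ⊕ q)) n
      ≡⟨ cong (½ *_) (⊛-distribˡ-⊕ (p ⊖ q) p q n) ⟩
    ½ * (((p ⊖ q) ⊛ p) n + ((p ⊖ q) ⊛ q) n)
      ≡⟨ cong (½ *_) (cong₂ _+_ (⊛-distribʳ-⊖ p q p n) (⊛-distribʳ-⊖ p q q n)) ⟩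
    ½ * (((p ⊛ p) n - (q ⊛ p) n) + ((p ⊛ q) n - (q ⊛ q) n))
      ≡⟨ cong₂ (λ x y → ½ * ((x - (q ⊛ p) n) + (y - (q ⊛ q) n))) (pp≈qq n) (⊛-comm p q n) ⟩
    ½ * (((q ⊛ q) n - (q ⊛ p) n) + ((q ⊛ p) n - (q ⊛ q) n))
      ≡⟨ solve 3 (λ c x y → c :* ((x :- y) :+ (y :- x)) := con 0ℚ) refl ½ ((q ⊛ q) n) ((q ⊛ p) n) ⟩
    0ℚ ∎
    where open ≡-Reasoning

tC : Series
tC = X ⊛ catalan

tC′ : Series
tC′ = deriv tC

1-4t : Series
1-4t = one ⊖ (ι 4 · X)

√1-4t : Series
√1-4t = one ⊖ (ι 2 · tC)

tC[1+n]≡catalan[n] : ∀ n → tC (suc n) ≡ catalan n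
tC[1+n]≡catalan[n] = X⊛f[1+n]≡f[n] catalan

tC′≡central : ∀ n → tC′ n ≡ ι (central n)
tC′≡central n = trans (cong (ι (suc n) *_) (tC[1+n]≡catalan[n] n)) (ι[1+n]*[m/1+n]≡ιm n (central n))

[1-4t]⊛f[0]≡f[0] : ∀ f → (1-4t ⊛ f) 0 ≡ f 0
[1-4t]⊛f[0]≡f[0] f = ℚP.*-identityˡ (f 0)

[1-4t]⊛f[1+n]≡f[1+n]-4f[n] : ∀ f n → (1-4t ⊛ f) (suc n) ≡ f (suc n) - ι 4 * f n
[1-4t]⊛f[1+n]≡f[1+n]-4f[n] f n = begin
  (1-4t ⊛ f) (suc n)                            ≡⟨ ⊛-distribʳ-⊖ one (ι 4 · X) f (suc n) ⟩
  (one ⊛ f) (suc n) - ((ι 4 · X) ⊛ f) (suc n)   ≡⟨ cong₂ _-_ (⊛-identityˡ f (suc n)) (⊛-·ˡ (ι 4) X f (suc n)) ⟩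
  f (suc n) - ι 4 * (X ⊛ f) (suc n)             ≡⟨ cong (λ x → f (suc n) - ι 4 * x) (X⊛f[1+n]≡f[n] f n) ⟩
  f (suc n) - ι 4 * f n                         ∎
  where open ≡-Reasoning

central-recurrenceℚ : ∀ n →
  ι (suc n) * ι (central (suc n)) + ι 2 * ι (central n) ≡ ι 4 * ι (suc n) * ι (central n)
central-recurrenceℚ n = begin
  ι (suc n) * ι (central (suc n)) + ι 2 * ι (central n)
    ≡⟨ cong₂ _+_ (ι-homo-* (suc n) (central (suc n))) (ι-homo-* 2 (central n)) ⟨
  ι (suc n ℕ.* central (suc n)) + ι (2 ℕ.* central n)
    ≡⟨ ι-homo-+ (suc n ℕ.* central (suc n)) (2 ℕ.* central n) ⟨
  ι (suc n ℕ.* central (suc n) ℕ.+ 2 ℕ.* central n)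
    ≡⟨ cong ι (central-recurrence n) ⟩
  ι (4 ℕ.* suc n ℕ.* central n)
    ≡⟨ trans (ι-homo-* (4 ℕ.* suc n) (central n)) (cong (_* ι (central n)) (ι-homo-* 4 (suc n))) ⟩
  ι 4 * ι (suc n) * ι (central n) ∎
  where
  open ≡-Reasoning

tC′-ODE : (1-4t ⊛ tC′) ≈ₛ √1-4t
tC′-ODE zero    = [1-4t]⊛f[0]≡f[0] tC′
tC′-ODE (suc m) = begin
  (1-4t ⊛ tC′) (suc m)        ≡⟨ [1-4t]⊛f[1+n]≡f[1+n]-4f[n] tC′ m ⟩
  tC′ (suc m) - ι 4 * tC′ m   ≡⟨ cong₂ (λ x y → x - ι 4 * y) (tC′≡central (suc m)) (tC′≡central m) ⟩
  b₁ - ι 4 * b₀               ≡⟨ ι-suc-*-cancelˡ m scaled ⟩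
  0ℚ - ι 2 * c                ≡⟨ cong (λ x → 0ℚ - ι 2 * x) (tC[1+n]≡catalan[n] m) ⟨
  √1-4t (suc m)               ∎
  where
  open ≡-Reasoning
  a = ι (suc m)
  b₁ = ι (central (suc m))
  b₀ = ι (central m)
  c = catalan m
  scaled : a * (b₁ - ι 4 * b₀) ≡ a * (0ℚ - ι 2 * c)
  scaled = begin
    a * (b₁ - ι 4 * b₀)
      ≡⟨ solve 4 (λ a b₁ b₀ t → a :* (b₁ :- (t :+ t) :* b₀) := (a :* b₁ :+ t :* b₀) :- t :* b₀ :- (t :+ t) :* a :* b₀) refl a b₁ b₀ (ι 2) ⟩
    (a * b₁ + ι 2 * b₀) - ι 2 * b₀ - ι 4 * a * b₀
      ≡⟨ cong (λ x → x - ι 2 * b₀ - ι 4 * a * b₀) (central-recurrenceℚ m) ⟩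
    ι 4 * a * b₀ - ι 2 * b₀ - ι 4 * a * b₀
      ≡⟨ solve 3 (λ a b₀ t → (t :+ t) :* a :* b₀ :- t :* b₀ :- (t :+ t) :* a :* b₀ := :- (t :* b₀)) refl a b₀ (ι 2) ⟩
    - (ι 2 * b₀)
      ≡⟨ cong (λ x → - (ι 2 * x)) (ι[1+n]*[m/1+n]≡ιm m (central m)) ⟨
    - (ι 2 * (a * c))
      ≡⟨ solve 3 (λ a c t → :- (t :* (a :* c)) := a :* (con 0ℚ :- t :* c)) refl a c (ι 2) ⟩
    a * (0ℚ - ι 2 * c) ∎

deriv-√1-4t : deriv √1-4t ≈ₛ ((- ι 2) · tC′)
deriv-√1-4t n = solve 3 (λ a t x → a :* (con 0ℚ :- t :* x) := (:- t) :* (a :* x)) refl (ι (suc n)) (ι 2) (tC (suc n))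

deriv-1-4t : deriv 1-4t ≈ₛ ((- ι 4) · one)
deriv-1-4t zero    = refl
deriv-1-4t (suc m) = trans (cong (ι (suc (suc m)) *_) 0-4*0≡0) (trans (ℚP.*-zeroʳ (ι (suc (suc m)))) (sym (ℚP.*-zeroʳ (- ι 4))))
  where
  0-4*0≡0 : 0ℚ - ι 4 * 0ℚ ≡ 0ℚ
  0-4*0≡0 = refl

[1-4t]⊛√1-4t⊛√1-4t′ : (1-4t ⊛ (√1-4t ⊛ deriv √1-4t)) ≈ₛ ((- ι 2) · (√1-4t ⊛ √1-4t))
[1-4t]⊛√1-4t⊛√1-4t′ = begin
  1-4t ⊛ (√1-4t ⊛ deriv √1-4t)          ≈⟨ ⊛-assoc 1-4t √1-4t (deriv √1-4t) ⟨
  (1-4t ⊛ √1-4t) ⊛ deriv √1-4t          ≈⟨ ⊛-congˡ (deriv √1-4t) (⊛-comm 1-4t √1-4t) ⟩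
  (√1-4t ⊛ 1-4t) ⊛ deriv √1-4t          ≈⟨ ⊛-assoc √1-4t 1-4t (deriv √1-4t) ⟩
  √1-4t ⊛ (1-4t ⊛ deriv √1-4t)          ≈⟨ ⊛-congʳ √1-4t (⊛-congʳ 1-4t deriv-√1-4t) ⟩
  √1-4t ⊛ (1-4t ⊛ ((- ι 2) · tC′))      ≈⟨ ⊛-congʳ √1-4t (⊛-·ʳ (- ι 2) 1-4t tC′) ⟩
  √1-4t ⊛ ((- ι 2) · (1-4t ⊛ tC′))      ≈⟨ ⊛-congʳ √1-4t (·-congʳ (- ι 2) tC′-ODE) ⟩
  √1-4t ⊛ ((- ι 2) · √1-4t)             ≈⟨ ⊛-·ʳ (- ι 2) √1-4t √1-4t ⟩
  (- ι 2) · (√1-4t ⊛ √1-4t)             ∎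
  where open ≈ₛ-Reasoning

√1-4t-squared : (√1-4t ⊛ √1-4t) ≈ₛ 1-4t
√1-4t-squared = ⊖≈0ₛ⇒≈ (linear-ODE-uniqueness {1-4t} {(- ι 4) · one} {defect} refl defect-ODE refl)
  where
  s = √1-4t
  defect : Series
  defect = (s ⊛ s) ⊖ 1-4t
  [1-4t]⊛[s²]′ : ∀ n → (1-4t ⊛ deriv (s ⊛ s)) n ≡ (- ι 2) * (s ⊛ s) n + (- ι 2) * (s ⊛ s) n
  [1-4t]⊛[s²]′ n = begin
    (1-4t ⊛ deriv (s ⊛ s)) n
      ≡⟨ ⊛-congʳ 1-4t (deriv-⊛ s s) n ⟩
    (1-4t ⊛ ((deriv s ⊛ s) ⊕ (s ⊛ deriv s))) n
      ≡⟨ ⊛-distribˡ-⊕ 1-4t (deriv s ⊛ s) (s ⊛ deriv s) n ⟩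
    (1-4t ⊛ (deriv s ⊛ s)) n + (1-4t ⊛ (s ⊛ deriv s)) n
      ≡⟨ cong (_+ (1-4t ⊛ (s ⊛ deriv s)) n) (⊛-congʳ 1-4t (⊛-comm (deriv s) s) n) ⟩
    (1-4t ⊛ (s ⊛ deriv s)) n + (1-4t ⊛ (s ⊛ deriv s)) n
      ≡⟨ cong₂ _+_ ([1-4t]⊛√1-4t⊛√1-4t′ n) ([1-4t]⊛√1-4t⊛√1-4t′ n) ⟩
    (- ι 2) * (s ⊛ s) n + (- ι 2) * (s ⊛ s) n ∎
    where open ≡-Reasoning
  [1-4t]⊛[1-4t]′ : ∀ n → (1-4t ⊛ deriv 1-4t) n ≡ (- ι 4) * 1-4t n
  [1-4t]⊛[1-4t]′ n =
    trans (⊛-congʳ 1-4t deriv-1-4t n) (trans (⊛-·ʳ (- ι 4) 1-4t one n) (cong ((- ι 4) *_) (⊛-identityʳ 1-4t n)))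
  defect-ODE : (1-4t ⊛ deriv defect) ≈ₛ (((- ι 4) · one) ⊛ defect)
  defect-ODE n = begin
    (1-4t ⊛ deriv defect) n
      ≡⟨ ⊛-congʳ 1-4t (deriv-⊖ (s ⊛ s) 1-4t) n ⟩
    (1-4t ⊛ (deriv (s ⊛ s) ⊖ deriv 1-4t)) n
      ≡⟨ ⊛-distribˡ-⊖ 1-4t (deriv (s ⊛ s)) (deriv 1-4t) n ⟩
    (1-4t ⊛ deriv (s ⊛ s)) n - (1-4t ⊛ deriv 1-4t) n
      ≡⟨ cong₂ _-_ ([1-4t]⊛[s²]′ n) ([1-4t]⊛[1-4t]′ n) ⟩
    ((- ι 2) * (s ⊛ s) n + (- ι 2) * (s ⊛ s) n) - (- ι 4) * 1-4t n
      ≡⟨ solve 3 (λ x y t → (:- t :* x :+ :- t :* x) :- (:- (t :+ t)) :* y := (:- (t :+ t)) :* (x :- y)) refl ((s ⊛ s) n) (1-4t n) (ι 2) ⟩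
    (- ι 4) * defect n
      ≡⟨ cong ((- ι 4) *_) (⊛-identityˡ defect n) ⟨
    (- ι 4) * (one ⊛ defect) n
      ≡⟨ ⊛-·ˡ (- ι 4) one defect n ⟨
    (((- ι 4) · one) ⊛ defect) n ∎
    where open ≡-Reasoning

tC-quadratic : tC ≈ₛ (X ⊕ (tC ⊛ tC))
tC-quadratic n = ι-suc-*-cancelˡ 3 (begin
  ι 4 * h                                 ≡⟨ solve 5 (λ o t x h hh → (t :+ t) :* h := (o :- t :* t :* x) :- (o :- t :* h :- t :* (h :- t :* hh)) :+ t :* t :* x :+ t :* t :* hh) refl (one n) (ι 2) (X n) h hh ⟩
  w - s² + ι 4 * X n + ι 4 * hh           ≡⟨ cong (λ y → w - y + ι 4 * X n + ι 4 * hh) square ⟩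
  w - w + ι 4 * X n + ι 4 * hh            ≡⟨ solve 4 (λ w t x hh → w :- w :+ (t :+ t) :* x :+ (t :+ t) :* hh := (t :+ t) :* (x :+ hh)) refl w (ι 2) (X n) hh ⟩
  ι 4 * (X n + hh)                        ∎)
  where
  open ≡-Reasoning
  h = tC n
  hh = (tC ⊛ tC) n
  w = 1-4t n
  s² = one n - ι 2 * h - ι 2 * (h - ι 2 * hh)
  [1-2h]² : ∀ n → (√1-4t ⊛ √1-4t) n ≡ one n - ι 2 * tC n - ι 2 * (tC n - ι 2 * (tC ⊛ tC) n)
  [1-2h]² n = trans (⊛-distribʳ-⊖ one (ι 2 · tC) √1-4t n)
    (cong₂ _-_ (⊛-identityˡ √1-4t n) (trans (⊛-·ˡ (ι 2) tC √1-4t n) (cong (ι 2 *_) h[1-2h])))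
    where
    h[1-2h] : (tC ⊛ √1-4t) n ≡ tC n - ι 2 * (tC ⊛ tC) n
    h[1-2h] = trans (⊛-distribˡ-⊖ tC one (ι 2 · tC) n) (cong₂ _-_ (⊛-identityʳ tC n) (⊛-·ʳ (ι 2) tC tC n))
  square : s² ≡ w
  square = trans (sym ([1-2h]² n)) (√1-4t-squared n)

tC′⊛√1-4t≈one : (tC′ ⊛ √1-4t) ≈ₛ one
tC′⊛√1-4t≈one = ⊛-cancelʳ {√1-4t} refl (begin
  (tC′ ⊛ √1-4t) ⊛ √1-4t     ≈⟨ ⊛-assoc tC′ √1-4t √1-4t ⟩
  tC′ ⊛ (√1-4t ⊛ √1-4t)     ≈⟨ ⊛-congʳ tC′ √1-4t-squared ⟩
  tC′ ⊛ 1-4t                ≈⟨ ⊛-comm tC′ 1-4t ⟩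
  1-4t ⊛ tC′                ≈⟨ tC′-ODE ⟩
  √1-4t                     ≈⟨ ⊛-identityˡ √1-4t ⟨
  one ⊛ √1-4t               ∎)
  where open ≈ₛ-Reasoning

DerCat≈R[d,[1-q]/2] : ∀ q d → q 0 ≡ 1ℚ → (q ⊛ q) ≈ₛ 1-4t → (d ⊛ q) ≈ₛ one → DerCat ≈ₘ R d (½ · (one ⊖ q))
DerCat≈R[d,[1-q]/2] q d q₀≡1 q²≈1-4t dq≈one n k =
  ⊛-cong (≈ₛ-sym d≈tC′) (pow-cong (≈ₛ-sym [1-q]/2≈tC) k) n
  where
  q≈√1-4t : q ≈ₛ √1-4t
  q≈√1-4t = ⊛-square-injective q₀≡1 refl (≈ₛ-trans q²≈1-4t (≈ₛ-sym √1-4t-squared))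
  d≈tC′ : d ≈ₛ tC′
  d≈tC′ = ⊛-cancelʳ {√1-4t} refl (begin
    d ⊛ √1-4t     ≈⟨ ⊛-congʳ d q≈√1-4t ⟨
    d ⊛ q         ≈⟨ dq≈one ⟩
    one           ≈⟨ tC′⊛√1-4t≈one ⟨
    tC′ ⊛ √1-4t   ∎)
    where open ≈ₛ-Reasoning
  [1-q]/2≈tC : (½ · (one ⊖ q)) ≈ₛ tC
  [1-q]/2≈tC m = begin
    ½ * (one m - q m)                       ≡⟨ cong (λ x → ½ * (one m - x)) (q≈√1-4t m) ⟩
    ½ * (one m - (one m - ι 2 * tC m))      ≡⟨ solve 4 (λ c o t x → c :* (o :- (o :- t :* x)) := (c :* t) :* x) refl ½ (one m) (ι 2) (tC m) ⟩
    (½ * ι 2) * tC m                        ≡⟨ ℚP.*-identityˡ (tC m) ⟩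
    tC m                                    ∎
    where open ≡-Reasoning

LowerTriangular : Matrix → Set
LowerTriangular A = ∀ n k → n < k → A n k ≡ 0ℚ

UnitDiagonal : Matrix → Set
UnitDiagonal A = ∀ n → A n n ≡ 1ℚ

R-lowerTriangular : ∀ d {h} → VanishesBelow 1 h → LowerTriangular (R d h)
R-lowerTriangular d h₀≡0 n k n<k = vanishesBelow-⊛ 0 k {d} (λ _ ()) (vanishesBelow-pow h₀≡0 k) n n<k

R-unitDiagonal : ∀ {d h} → d 0 ≡ 1ℚ → VanishesBelow 1 h → h 1 ≡ 1ℚ → UnitDiagonal (R d h)
R-unitDiagonal {d} {h} d₀≡1 h₀≡0 h₁≡1 k = begin
  (d ⊛ pow h k) k   ≡⟨ ⊛-unit-leading d k (vanishesBelow-pow h₀≡0 k) ⟩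
  d 0 * pow h k k   ≡⟨ cong₂ _*_ d₀≡1 (pow-diagonal h₀≡0 h₁≡1 k) ⟩
  1ℚ * 1ℚ           ≡⟨ ℚP.*-identityˡ 1ℚ ⟩
  1ℚ                ∎
  where open ≡-Reasoning

Id-diagonal : UnitDiagonal Id
Id-diagonal zero    = refl
Id-diagonal (suc n) = Id-diagonal n

Id-offDiagonal : ∀ n k → n ≢ k → Id n k ≡ 0ℚ
Id-offDiagonal zero    zero    n≢k = ⊥-elim (n≢k refl)
Id-offDiagonal zero    (suc k) n≢k = refl
Id-offDiagonal (suc n) zero    n≢k = refl
Id-offDiagonal (suc n) (suc k) n≢k = Id-offDiagonal n k (n≢k ∘ cong suc)

Id-lowerTriangular : LowerTriangular Id
Id-lowerTriangular n k n<k = Id-offDiagonal n k (ℕP.<⇒≢ n<k)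

⊠-identityˡ : ∀ A → (Id ⊠ A) ≈ₘ A
⊠-identityˡ A n k =
  trans (sumTo-single n n (λ j → Id n j * A j k) ℕP.≤-refl off) (trans (cong (_* A n k) (Id-diagonal n)) (ℚP.*-identityˡ (A n k)))
  where
  off : ∀ j → j ≤ n → j ≢ n → Id n j * A j k ≡ 0ℚ
  off j _ j≢n = trans (cong (_* A j k) (Id-offDiagonal n j (j≢n ∘ sym))) (ℚP.*-zeroˡ (A j k))

⊠-identityʳ : ∀ {A} → LowerTriangular A → (A ⊠ Id) ≈ₘ A
⊠-identityʳ {A} A-lower n k with k ℕP.≤? n
... | yes k≤n = trans (sumTo-single n k (λ i → A n i * Id i k) k≤n off)
                      (trans (cong (A n k *_) (Id-diagonal k)) (ℚP.*-identityʳ (A n k)))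
  where
  off : ∀ i → i ≤ n → i ≢ k → A n i * Id i k ≡ 0ℚ
  off i _ i≢k = trans (cong (A n i *_) (Id-offDiagonal i k i≢k)) (ℚP.*-zeroʳ (A n i))
... | no k≰n = trans (sumTo-zero n _ off) (sym (A-lower n k (ℕP.≰⇒> k≰n)))
  where
  off : ∀ i → i ≤ n → A n i * Id i k ≡ 0ℚ
  off i i≤n = trans (cong (A n i *_) (Id-lowerTriangular i k (ℕP.≤-<-trans i≤n (ℕP.≰⇒> k≰n)))) (ℚP.*-zeroʳ (A n i))

⊠-lowerTriangular : ∀ A {B} → LowerTriangular B → LowerTriangular (A ⊠ B)
⊠-lowerTriangular A {B} B-lower n k n<k = sumTo-zero n _ λ j j≤n →
  trans (cong (A n j *_) (B-lower j k (ℕP.≤-<-trans j≤n n<k))) (ℚP.*-zeroʳ (A n j))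

⊠-assoc : ∀ A {B} C → LowerTriangular B → ((A ⊠ B) ⊠ C) ≈ₘ (A ⊠ (B ⊠ C))
⊠-assoc A {B} C B-lower n k = begin
  sumTo n (λ j → sumTo n (λ i → A n i * B i j) * C j k)
    ≡⟨ sumTo-cong′ n (λ j → sym (sumTo-*ʳ n (C j k) (λ i → A n i * B i j))) ⟩
  sumTo n (λ j → sumTo n (λ i → A n i * B i j * C j k))
    ≡⟨ sumTo-swap n n (λ j i → A n i * B i j * C j k) ⟩
  sumTo n (λ i → sumTo n (λ j → A n i * B i j * C j k))
    ≡⟨ sumTo-cong′ n (λ i → trans (sumTo-cong′ n (λ j → ℚP.*-assoc (A n i) (B i j) (C j k))) (sumTo-*ˡ n (A n i) _)) ⟩
  sumTo n (λ i → A n i * sumTo n (λ j → B i j * C j k))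
    ≡⟨ sumTo-cong n (λ i i≤n → cong (A n i *_) (sumTo-extend i n _ i≤n (beyond i))) ⟩
  sumTo n (λ i → A n i * sumTo i (λ j → B i j * C j k)) ∎
  where
  open ≡-Reasoning
  beyond : ∀ i j → i < j → B i j * C j k ≡ 0ℚ
  beyond i j i<j = trans (cong (_* C j k) (B-lower i j i<j)) (ℚP.*-zeroˡ (C j k))

row-cancel : ∀ {B} → LowerTriangular B → UnitDiagonal B → ∀ n (r : ℕ → ℚ) →
             (∀ k → sumTo n (λ j → r j * B j k) ≡ 0ℚ) → ∀ j → j ≤ n → r j ≡ 0ℚ
row-cancel {B} B-lower B-diag n r rB≡0 j j≤n = descend n j j≤n (ℕP.m≤m+n n j)
  where
  pivot : ∀ j → j ≤ n → (∀ i → j < i → i ≤ n → r i ≡ 0ℚ) → r j ≡ 0ℚ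
  pivot j j≤n r>j≡0 = begin
    r j                          ≡⟨ ℚP.*-identityʳ (r j) ⟨
    r j * 1ℚ                     ≡⟨ cong (r j *_) (B-diag j) ⟨
    r j * B j j                  ≡⟨ sumTo-single n j (λ i → r i * B i j) j≤n off ⟨
    sumTo n (λ i → r i * B i j)  ≡⟨ rB≡0 j ⟩
    0ℚ                           ∎
    where
    open ≡-Reasoning
    off : ∀ i → i ≤ n → i ≢ j → r i * B i j ≡ 0ℚ
    off i i≤n i≢j with i ℕP.<? j
    ... | yes i<j = trans (cong (r i *_) (B-lower i j i<j)) (ℚP.*-zeroʳ (r i))
    ... | no  i≮j = trans (cong (_* B i j) (r>j≡0 i (ℕP.≤∧≢⇒< (ℕP.≮⇒≥ i≮j) (i≢j ∘ sym)) i≤n)) (ℚP.*-zeroˡ (B i j))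
  descend : ∀ d j → j ≤ n → n ≤ d ℕ.+ j → r j ≡ 0ℚ
  descend zero    j j≤n n≤j = pivot j j≤n λ i j<i i≤n →
    ⊥-elim (ℕP.<-irrefl refl (ℕP.<-≤-trans j<i (ℕP.≤-trans i≤n n≤j)))
  descend (suc d) j j≤n n≤1+d+j = pivot j j≤n λ i j<i i≤n →
    descend d i i≤n (ℕP.≤-trans n≤1+d+j (ℕP.≤-trans (ℕP.≤-reflexive (sym (ℕP.+-suc d j))) (ℕP.+-monoʳ-≤ d j<i)))

⊠-inverseʳ : ∀ {A B} → LowerTriangular A → LowerTriangular B → UnitDiagonal B →
             (A ⊠ B) ≈ₘ Id → (B ⊠ A) ≈ₘ Id
⊠-inverseʳ {A} {B} A-lower B-lower B-diag AB≈Id n k with k ℕP.≤? n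
... | yes k≤n = x-y≡0⇒x≡y _ _ (row-cancel B-lower B-diag n (λ j → (B ⊠ A) n j - Id n j) defect≡0 k k≤n)
  where
  open ≡-Reasoning
  BAB≈B : ((B ⊠ A) ⊠ B) ≈ₘ B
  BAB≈B n k = begin
    ((B ⊠ A) ⊠ B) n k  ≡⟨ ⊠-assoc B B A-lower n k ⟩
    (B ⊠ (A ⊠ B)) n k  ≡⟨ sumTo-cong′ n (λ j → cong (B n j *_) (AB≈Id j k)) ⟩
    (B ⊠ Id) n k       ≡⟨ ⊠-identityʳ B-lower n k ⟩
    B n k              ∎
  defect≡0 : ∀ k → sumTo n (λ j → ((B ⊠ A) n j - Id n j) * B j k) ≡ 0ℚ
  defect≡0 k = begin
    sumTo n (λ j → ((B ⊠ A) n j - Id n j) * B j k)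
      ≡⟨ sumTo-cong′ n (λ j → solve 3 (λ x y z → (x :- y) :* z := x :* z :- y :* z) refl ((B ⊠ A) n j) (Id n j) (B j k)) ⟩
    sumTo n (λ j → (B ⊠ A) n j * B j k - Id n j * B j k)
      ≡⟨ sumTo-- n _ _ ⟩
    ((B ⊠ A) ⊠ B) n k - (Id ⊠ B) n k
      ≡⟨ cong₂ _-_ (BAB≈B n k) (⊠-identityˡ B n k) ⟩
    B n k - B n k
      ≡⟨ ℚP.+-inverseʳ (B n k) ⟩
    0ℚ ∎
... | no k≰n = trans (⊠-lowerTriangular B A-lower n k n<k) (sym (Id-lowerTriangular n k n<k))
  where n<k = ℕP.≰⇒> k≰n

sumTo-*-X⊛ : ∀ N (r : ℕ → ℚ) g → r (suc N) ≡ 0ℚ →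
             sumTo N (λ j → r j * (X ⊛ g) j) ≡ sumTo N (λ j → r (suc j) * g j)
sumTo-*-X⊛ zero    r g r₁≡0 =
  trans (trans (cong (r 0 *_) (X⊛f[0]≡0 g)) (ℚP.*-zeroʳ (r 0))) (sym (trans (cong (_* g 0) r₁≡0) (ℚP.*-zeroˡ (g 0))))
sumTo-*-X⊛ (suc N) r g r[2+N]≡0 = begin
  sumTo (suc N) (λ j → r j * (X ⊛ g) j)
    ≡⟨ sumTo-sucˡ N (λ j → r j * (X ⊛ g) j) ⟩
  r 0 * (X ⊛ g) 0 + sumTo N (λ j → r (suc j) * (X ⊛ g) (suc j))
    ≡⟨ cong₂ _+_ (trans (cong (r 0 *_) (X⊛f[0]≡0 g)) (ℚP.*-zeroʳ (r 0))) (sumTo-cong′ N (λ j → cong (r (suc j) *_) (X⊛f[1+n]≡f[n] g j))) ⟩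
  0ℚ + sumTo N (λ j → r (suc j) * g j)
    ≡⟨ ℚP.+-identityˡ _ ⟩
  sumTo N (λ j → r (suc j) * g j)
    ≡⟨ ℚP.+-identityʳ _ ⟨
  sumTo N (λ j → r (suc j) * g j) + 0ℚ
    ≡⟨ cong (λ x → sumTo N (λ j → r (suc j) * g j) + x) (trans (cong (_* g (suc N)) r[2+N]≡0) (ℚP.*-zeroˡ (g (suc N)))) ⟨
  sumTo (suc N) (λ j → r (suc j) * g j) ∎
  where open ≡-Reasoning

tC-vanishesBelow-1 : VanishesBelow 1 tC
tC-vanishesBelow-1 zero    _ = refl
tC-vanishesBelow-1 (suc i) (s≤s ())

DerCat-lowerTriangular : LowerTriangular DerCat
DerCat-lowerTriangular = R-lowerTriangular tC′ tC-vanishesBelow-1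

DerCat-column-recurrence : ∀ j → (tC′ ⊛ pow tC (suc j)) ≈ₛ ((X ⊛ (tC′ ⊛ pow tC j)) ⊕ (tC′ ⊛ pow tC (suc (suc j))))
DerCat-column-recurrence j = begin
  tC′ ⊛ (tC ⊛ p)
    ≈⟨ ⊛-congʳ tC′ (⊛-congˡ p tC-quadratic) ⟩
  tC′ ⊛ ((X ⊕ (tC ⊛ tC)) ⊛ p)
    ≈⟨ ⊛-congʳ tC′ (⊛-distribʳ-⊕ X (tC ⊛ tC) p) ⟩
  tC′ ⊛ ((X ⊛ p) ⊕ ((tC ⊛ tC) ⊛ p))
    ≈⟨ ⊛-distribˡ-⊕ tC′ (X ⊛ p) ((tC ⊛ tC) ⊛ p) ⟩
  (tC′ ⊛ (X ⊛ p)) ⊕ (tC′ ⊛ ((tC ⊛ tC) ⊛ p))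
    ≈⟨ ⊕-cong shift (⊛-congʳ tC′ (⊛-assoc tC tC p)) ⟩
  (X ⊛ (tC′ ⊛ p)) ⊕ (tC′ ⊛ (tC ⊛ (tC ⊛ p))) ∎
  where
  open ≈ₛ-Reasoning
  p = pow tC j
  shift : (tC′ ⊛ (X ⊛ p)) ≈ₛ (X ⊛ (tC′ ⊛ p))
  shift = ≈ₛ-trans (≈ₛ-sym (⊛-assoc tC′ X p)) (≈ₛ-trans (⊛-congˡ p (⊛-comm tC′ X)) (⊛-assoc X tC′ p))

DerCat-pascal : ∀ m j → DerCat (suc m) (suc j) ≡ DerCat m j + DerCat (suc m) (suc (suc j))
DerCat-pascal m j =
  trans (DerCat-column-recurrence j (suc m)) (cong (_+ DerCat (suc m) (suc (suc j))) (X⊛f[1+n]≡f[n] (tC′ ⊛ pow tC j) m))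

DerCat-column0 : ∀ n → DerCat n 0 ≡ ι (central n)
DerCat-column0 n = trans (⊛-identityʳ tC′ n) (tC′≡central n)

DerCat-column0-2column1 : ∀ n → DerCat n 0 - ι 2 * DerCat n 1 ≡ one n
DerCat-column0-2column1 n = begin
  DerCat n 0 - ι 2 * DerCat n 1           ≡⟨ cong (λ x → DerCat n 0 - ι 2 * x) (⊛-congʳ tC′ (⊛-identityʳ tC) n) ⟩
  (tC′ ⊛ one) n - ι 2 * (tC′ ⊛ tC) n      ≡⟨ cong (λ x → (tC′ ⊛ one) n - x) (⊛-·ʳ (ι 2) tC′ tC n) ⟨
  (tC′ ⊛ one) n - (tC′ ⊛ (ι 2 · tC)) n    ≡⟨ ⊛-distribˡ-⊖ tC′ one (ι 2 · tC) n ⟨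
  (tC′ ⊛ √1-4t) n                         ≡⟨ tC′⊛√1-4t≈one n ⟩
  one n                                   ∎
  where open ≡-Reasoning

DerCat≡derCatBinomial : ∀ k n → k ≤ n → DerCat n k ≡ ι (derCatBinomial n k)
DerCat≡derCatBinomial zero n _ = DerCat-column0 n
DerCat≡derCatBinomial (suc zero) (suc m) _ = ι-suc-*-cancelˡ 1 (begin
  ι 2 * DerCat (suc m) 1
    ≡⟨ solve 2 (λ x y → y := x :- (x :- y)) refl (DerCat (suc m) 0) (ι 2 * DerCat (suc m) 1) ⟩
  DerCat (suc m) 0 - (DerCat (suc m) 0 - ι 2 * DerCat (suc m) 1)
    ≡⟨ cong₂ _-_ (DerCat-column0 (suc m)) (DerCat-column0-2column1 (suc m)) ⟩
  ι (central (suc m)) - 0ℚ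
    ≡⟨ ℚP.+-identityʳ (ι (central (suc m))) ⟩
  ι (central (suc m))
    ≡⟨ cong ι (central[1+n]≡2*[1+2n]Cn m) ⟩
  ι (2 ℕ.* (suc (2 ℕ.* m) C m))
    ≡⟨ ι-homo-* 2 (suc (2 ℕ.* m) C m) ⟩
  ι 2 * ι (suc (2 ℕ.* m) C m)
    ≡⟨ cong (λ x → ι 2 * ι ((x ∸ 1) C m)) (2[1+n]≡2+2n m) ⟨
  ι 2 * ι (derCatBinomial (suc m) 1) ∎)
  where open ≡-Reasoning
DerCat≡derCatBinomial (suc (suc k)) (suc m) (s≤s k+1≤m) = begin
  DerCat (suc m) (suc (suc k))
    ≡⟨ solve 2 (λ x z → z := (x :+ z) :- x) refl (DerCat m k) (DerCat (suc m) (suc (suc k))) ⟩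
  (DerCat m k + DerCat (suc m) (suc (suc k))) - DerCat m k
    ≡⟨ cong (_- DerCat m k) (DerCat-pascal m k) ⟨
  DerCat (suc m) (suc k) - DerCat m k
    ≡⟨ cong₂ _-_ (DerCat≡derCatBinomial (suc k) (suc m) (s≤s (ℕP.<⇒≤ k+1≤m)))
                 (DerCat≡derCatBinomial k m (ℕP.<⇒≤ k+1≤m)) ⟩
  ι (derCatBinomial (suc m) (suc k)) - ι (derCatBinomial m k)
    ≡⟨ cong (λ x → ι x - ι (derCatBinomial m k)) (derCatBinomial-pascal m k k+1≤m) ⟩
  ι (derCatBinomial m k ℕ.+ derCatBinomial (suc m) (suc (suc k))) - ι (derCatBinomial m k)
    ≡⟨ cong (_- ι (derCatBinomial m k)) (ι-homo-+ (derCatBinomial m k) (derCatBinomial (suc m) (suc (suc k)))) ⟩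
  (ι (derCatBinomial m k) + ι (derCatBinomial (suc m) (suc (suc k)))) - ι (derCatBinomial m k)
    ≡⟨ solve 2 (λ x y → (x :+ y) :- x := y) refl (ι (derCatBinomial m k)) (ι (derCatBinomial (suc m) (suc (suc k)))) ⟩
  ι (derCatBinomial (suc m) (suc (suc k))) ∎
  where open ≡-Reasoning

1-2t : Series
1-2t = one ⊖ (ι 2 · X)

t-t² : Series
t-t² = X ⊖ (X ⊛ X)

DerCat⁻¹ : Matrix
DerCat⁻¹ = R 1-2t t-t²

t-t²-vanishesBelow-1 : VanishesBelow 1 t-t²
t-t²-vanishesBelow-1 zero    _ = refl
t-t²-vanishesBelow-1 (suc i) (s≤s ())

DerCat⁻¹-lowerTriangular : LowerTriangular DerCat⁻¹
DerCat⁻¹-lowerTriangular = R-lowerTriangular 1-2t t-t²-vanishesBelow-1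

DerCat⁻¹-unitDiagonal : UnitDiagonal DerCat⁻¹
DerCat⁻¹-unitDiagonal = R-unitDiagonal {1-2t} refl t-t²-vanishesBelow-1 refl

DerCat⁻¹-column-recurrence : ∀ k → let c = 1-2t ⊛ pow t-t² k in
                             (1-2t ⊛ pow t-t² (suc k)) ≈ₛ ((X ⊛ c) ⊖ (X ⊛ (X ⊛ c)))
DerCat⁻¹-column-recurrence k = begin
  1-2t ⊛ (t-t² ⊛ p)             ≈⟨ ⊛-assoc 1-2t t-t² p ⟨
  (1-2t ⊛ t-t²) ⊛ p             ≈⟨ ⊛-congˡ p (⊛-comm 1-2t t-t²) ⟩
  (t-t² ⊛ 1-2t) ⊛ p             ≈⟨ ⊛-assoc t-t² 1-2t p ⟩
  t-t² ⊛ c                      ≈⟨ ⊛-distribʳ-⊖ X (X ⊛ X) c ⟩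
  (X ⊛ c) ⊖ ((X ⊛ X) ⊛ c)       ≈⟨ ⊖-cong (≈ₛ-refl {X ⊛ c}) (⊛-assoc X X c) ⟩
  (X ⊛ c) ⊖ (X ⊛ (X ⊛ c))       ∎
  where
  open ≈ₛ-Reasoning
  p = pow t-t² k
  c = 1-2t ⊛ p

-- Column k + 1 of R(1 − 2t, t − t²) is (t − t²) times column k, and against row m + 1 of
-- Der(Cat) the column recurrence D(m+1,j+1) = D(m,j) + D(m+1,j+2) telescopes it to row m.
DerCat⊠DerCat⁻¹≈Id : (DerCat ⊠ DerCat⁻¹) ≈ₘ Id
DerCat⊠DerCat⁻¹≈Id n zero = begin
  sumTo n (λ j → DerCat n j * (1-2t ⊛ one) j)
    ≡⟨ sumTo-cong′ n (λ j → cong (DerCat n j *_) (column0 j)) ⟩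
  sumTo n (λ j → DerCat n j * (one j - ι 2 * (X ⊛ one) j))
    ≡⟨ sumTo-cong′ n (λ j → solve 4 (λ d o t x → d :* (o :- t :* x) := d :* o :- t :* (d :* x)) refl (DerCat n j) (one j) (ι 2) ((X ⊛ one) j)) ⟩
  sumTo n (λ j → DerCat n j * one j - ι 2 * (DerCat n j * (X ⊛ one) j))
    ≡⟨ sumTo-- n _ _ ⟩
  sumTo n (λ j → DerCat n j * one j) - sumTo n (λ j → ι 2 * (DerCat n j * (X ⊛ one) j))
    ≡⟨ cong₂ _-_ (sumTo-*-one n (DerCat n)) (sumTo-*ˡ n (ι 2) _) ⟩
  DerCat n 0 - ι 2 * sumTo n (λ j → DerCat n j * (X ⊛ one) j)
    ≡⟨ cong (λ x → DerCat n 0 - ι 2 * x) (sumTo-*-X⊛ n (DerCat n) one (DerCat-lowerTriangular n (suc n) ℕP.≤-refl)) ⟩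
  DerCat n 0 - ι 2 * sumTo n (λ j → DerCat n (suc j) * one j)
    ≡⟨ cong (λ x → DerCat n 0 - ι 2 * x) (sumTo-*-one n (λ j → DerCat n (suc j))) ⟩
  DerCat n 0 - ι 2 * DerCat n 1
    ≡⟨ DerCat-column0-2column1 n ⟩
  one n ∎
  where
  open ≡-Reasoning
  column0 : ∀ j → (1-2t ⊛ one) j ≡ one j - ι 2 * (X ⊛ one) j
  column0 j = trans (⊛-identityʳ 1-2t j) (cong (λ x → one j - ι 2 * x) (sym (⊛-identityʳ X j)))
DerCat⊠DerCat⁻¹≈Id zero (suc k) =
  trans (cong (DerCat 0 0 *_) (DerCat⁻¹-lowerTriangular 0 (suc k) (s≤s z≤n))) (ℚP.*-zeroʳ (DerCat 0 0))
DerCat⊠DerCat⁻¹≈Id (suc m) (suc k) = begin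
  sumTo (suc m) (λ j → r j * (1-2t ⊛ pow t-t² (suc k)) j)
    ≡⟨ sumTo-cong′ (suc m) (λ j → trans (cong (r j *_) (DerCat⁻¹-column-recurrence k j)) (distrib j)) ⟩
  sumTo (suc m) (λ j → r j * (X ⊛ c) j - r j * (X ⊛ (X ⊛ c)) j)
    ≡⟨ sumTo-- (suc m) _ _ ⟩
  sumTo (suc m) (λ j → r j * (X ⊛ c) j) - sumTo (suc m) (λ j → r j * (X ⊛ (X ⊛ c)) j)
    ≡⟨ cong₂ _-_ (sumTo-*-X⊛ (suc m) r c (beyond _ ℕP.≤-refl))
                 (trans (sumTo-*-X⊛ (suc m) r (X ⊛ c) (beyond _ ℕP.≤-refl)) (sumTo-*-X⊛ (suc m) (r ∘ suc) c (beyond _ (ℕP.n≤1+n _)))) ⟩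
  sumTo (suc m) (λ j → r (suc j) * c j) - sumTo (suc m) (λ j → r (suc (suc j)) * c j)
    ≡⟨ sumTo-- (suc m) _ _ ⟨
  sumTo (suc m) (λ j → r (suc j) * c j - r (suc (suc j)) * c j)
    ≡⟨ sumTo-cong′ (suc m) telescope ⟩
  sumTo (suc m) (λ j → DerCat m j * c j)
    ≡⟨ cong₂ _+_ (DerCat⊠DerCat⁻¹≈Id m k) (trans (cong (_* c (suc m)) (DerCat-lowerTriangular m (suc m) ℕP.≤-refl)) (ℚP.*-zeroˡ (c (suc m)))) ⟩
  Id m k + 0ℚ
    ≡⟨ ℚP.+-identityʳ (Id m k) ⟩
  Id m k ∎
  where
  open ≡-Reasoning
  r = DerCat (suc m)
  c = 1-2t ⊛ pow t-t² k
  beyond : ∀ j → suc m < j → r j ≡ 0ℚ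
  beyond = DerCat-lowerTriangular (suc m)
  distrib : ∀ j → r j * ((X ⊛ c) j - (X ⊛ (X ⊛ c)) j) ≡ r j * (X ⊛ c) j - r j * (X ⊛ (X ⊛ c)) j
  distrib j = solve 3 (λ a x y → a :* (x :- y) := a :* x :- a :* y) refl (r j) ((X ⊛ c) j) ((X ⊛ (X ⊛ c)) j)
  telescope : ∀ j → r (suc j) * c j - r (suc (suc j)) * c j ≡ DerCat m j * c j
  telescope j = trans (cong (λ x → x * c j - r (suc (suc j)) * c j) (DerCat-pascal m j))
    (solve 3 (λ a b x → (a :+ b) :* x :- b :* x := a :* x) refl (DerCat m j) (r (suc (suc j))) (c j))

theorem5p7 : ((q d : Series) → q 0 ≡ 1ℚ → (q ⊛ q) ≈ₛ (one ⊖ (ι 4 · X)) → (d ⊛ q) ≈ₛ one →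
      DerCat ≈ₘ R d (½ · (one ⊖ q)))
    × ((DerCat ⊠ R (one ⊖ (ι 2 · X)) (X ⊖ (X ⊛ X))) ≈ₘ Id
       × (R (one ⊖ (ι 2 · X)) (X ⊖ (X ⊛ X)) ⊠ DerCat) ≈ₘ Id)
    × ((n k : ℕ) → k ≤ n → DerCat n k ≡ + (((2 ℕ.* n) ∸ k) C (n ∸ k)) / 1)
theorem5p7 =
    DerCat≈R[d,[1-q]/2]
  , ( DerCat⊠DerCat⁻¹≈Id
    , ⊠-inverseʳ DerCat-lowerTriangular DerCat⁻¹-lowerTriangular DerCat⁻¹-unitDiagonal DerCat⊠DerCat⁻¹≈Id )
  , λ n k k≤n → DerCat≡derCatBinomial k n k≤n
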